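{- Let $\mathsf{K}$ be one of $\mathsf{PSL},\mathsf{ISL},\mathsf{bISL},\mathsf{PDL},\mathsf{IL},\mathsf{HA}$. For every $\boldsymbol{A},\boldsymbol{B}\in\mathsf{K}$ and posets $\mathbb{X},\mathbb{Y}$: (i) if $f\colon\boldsymbol{A}\to\boldsymbol{B}$ is a homomorphism, then $f_\ast\colon\boldsymbol{B}_\ast\rightharpoonup\boldsymbol{A}_\ast$ is an arrow of $\mathsf{K}^\partial$; (ii) if $p\colon\mathbb{X}\rightharpoonup\mathbb{Y}$ is an arrow of $\mathsf{K}^\partial$, then $\mathsf{Up}_{\mathsf{K}}(p)\colon\mathsf{Up}_{\mathsf{K}}(\mathbb{Y})\to\mathsf{Up}_{\mathsf{K}}(\mathbb{X})$ is a homomorphism. Moreover, if $f$ is injective then $f_\ast$ is surjective, and if $p$ is surjective then $\mathsf{Up}_{\mathsf{K}}(p)$ is injective.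
   Context: Varieties and languages: $\mathsf{PSL}$, pseudocomplemented semilattices $\langle A;\wedge,\neg,0,1\rangle$ (semilattices with least $0$, greatest $1$, $\neg a$ the largest $c$ with $c\wedge a=0$); $\mathsf{ISL}$, implicative semilattices $\langle A;\wedge,\to,1\rangle$ ($a\to b$ the largest $c$ with $c\wedge a\le b$); $\mathsf{bISL}$, bounded implicative semilattices $\langle A;\wedge,\to,0,1\rangle$; $\mathsf{PDL}$, pseudocomplemented distributive lattices $\langle A;\wedge,\vee,\neg,0,1\rangle$; $\mathsf{IL}$, implicative lattices $\langle A;\wedge,\vee,\to,1\rangle$; $\mathsf{HA}$, Heyting algebras $\langle A;\wedge,\vee,\to,0,1\rangle$. For $\boldsymbol{A}$ in one of these, a filter of $\boldsymbol{A}$ is a nonempty upset of $\langle A;\le\rangle$ closed under $\wedge$; it is meet irreducible if proper and not the intersection of two filters both different from it; $\boldsymbol{A}_\ast$ is the poset of meet irreducible filters under inclusion. For a homomorphism $f\colon\boldsymbol{A}\to\boldsymbol{B}$, $f_\ast\colon\boldsymbol{B}_\ast\rightharpoonup\boldsymbol{A}_\ast$ is the partial function with domain $\{F\in\boldsymbol{B}_\ast: f^{ -1}[F]\in\boldsymbol{A}_\ast\}$ and $f_\ast(F)=f^{ -1}[F]$. A partial function $p\colon\mathbb{X}\rightharpoonup\mathbb{Y}$ between posets (with domain $\mathrm{dom}(p)\subseteq X$) is order preserving if $x\le z$ implies $p(x)\le p(z)$ for $x,z\in\mathrm{dom}(p)$; it is surjective if its range is $Y$; it is almost total if $\mathrm{dom}(p)$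 is a downset. An order preserving partial $p$ is a partial negative p-morphism if $X={\downarrow}\{x\in X:{\uparrow}x\subseteq\mathrm{dom}(p)\}$ and for all $x\in\mathrm{dom}(p)$, $y\in Y$ with $p(x)\le y$ there is $z\in\mathrm{dom}(p)$ with $x\le z$ and $y\le p(z)$; a partial positive p-morphism if for all $x\in\mathrm{dom}(p)$, $y\in Y$ with $p(x)\le y$ there is $z\in\mathrm{dom}(p)$ with $x\le z$ and $y=p(z)$; a partial p-morphism if both. Dropping "partial" means $p$ is total. The arrows of $\mathsf{K}^\partial$ are: for $\mathsf{PSL}$, partial negative p-morphisms; for $\mathsf{ISL}$, partial positive p-morphisms; for $\mathsf{bISL}$, partial p-morphisms; for $\mathsf{PDL}$, (total) negative p-morphisms; for $\mathsf{IL}$, almost total partial positive p-morphisms; for $\mathsf{HA}$, (total) p-morphisms. For a poset $\mathbb{X}$, $\mathsf{Up}_{\mathsf{K}}(\mathbb{X})$ is the reduct to the language of $\mathsf{K}$ of the Heyting algebra $\langle\mathrm{Up}(\mathbb{X});\cap,\cup,\to,\emptyset,X\rangle$ of upsets, where $U\to V=X\setminus{\downarrow}(U\setminus V)$ (and $\neg U=U\to\emptyset$). For $p\colon\mathbb{X}\rightharpoonup\mathbb{Y}$, $\mathsf{Up}_{\mathsf{K}}(p)(U)=X\setminus{\downarrow}p^{ -1}[Y\setminus U]$. -}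

module Defs where

open import Level using (Level; _⊔_; suc; Lift; lift)
open import Data.Empty using (⊥)
open import Data.Unit using (⊤; tt)
open import Data.Product using (Σ; _×_; _,_; proj₁; proj₂)
open import Data.Sum using (_⊎_; inj₁; inj₂)
open import Relation.Nullary using (¬_)
open import Relation.Binary.PropositionalEquality using (_≡_)
open import Relation.Binary.Bundles using (Poset)
open import Relation.Binary.Structures using (IsPartialOrder; IsPreorder; IsEquivalence)

Zorn : (a r : Level) → Set (suc (a ⊔ r))
Zorn a r = (P : Set a) (_≤_ : P → P → Set r) →
  (∀ x → x ≤ x) → (∀ x y z → x ≤ y → y ≤ z → x ≤ z) →
  ((C : P → Set (a ⊔ r)) → (∀ x y → C x → C y → (x ≤ y) ⊎ (y ≤ x)) →
     Σ P λ u → ∀ x → C x → x ≤ u) →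
  Σ P λ m → ∀ x → m ≤ x → x ≤ m

module _ {a : Level} {A : Set a} where
  _≐_ : ∀ {ℓ} (P Q : A → Set ℓ) → Set (a ⊔ ℓ)
  P ≐ Q = ∀ x → (P x → Q x) × (Q x → P x)

  _⊆_ : ∀ {ℓ} (P Q : A → Set ℓ) → Set (a ⊔ ℓ)
  P ⊆ Q = ∀ x → P x → Q x

data Variety : Set where
  PSL ISL bISL PDL IL HA : Variety

HasJoin : Variety → Set
HasJoin PDL = ⊤
HasJoin IL  = ⊤
HasJoin HA  = ⊤
HasJoin _   = ⊥

HasImp : Variety → Set
HasImp ISL  = ⊤
HasImp bISL = ⊤
HasImp IL   = ⊤
HasImp HA   = ⊤
HasImp _    = ⊥

-- does the language contain ¬ (as a basic operation) ?
HasNeg : Variety → Set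
HasNeg PSL = ⊤
HasNeg PDL = ⊤
HasNeg _   = ⊥

HasBot : Variety → Set
HasBot PSL  = ⊤
HasBot bISL = ⊤
HasBot PDL  = ⊤
HasBot HA   = ⊤
HasBot _    = ⊥

neg⇒bot : ∀ {K} → HasNeg K → HasBot K
neg⇒bot {PSL} _ = tt
neg⇒bot {PDL} _ = tt

record Algebra (K : Variety) (ℓ : Level) : Set (suc ℓ) where
  infixr 7 _∧_
  field
    Carrier : Set ℓ
    _∧_  : Carrier → Carrier → Carrier
    top  : Carrier
    join : HasJoin K → Carrier → Carrier → Carrier
    imp  : HasImp K → Carrier → Carrier → Carrier
    neg  : HasNeg K → Carrier → Carrier
    bot  : HasBot K → Carrier

  _≤_ : Carrier → Carrier → Set ℓ
  a ≤ b = a ∧ b ≡ a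

  field
    ∧-assoc : ∀ a b c → (a ∧ b) ∧ c ≡ a ∧ (b ∧ c)
    ∧-comm  : ∀ a b → a ∧ b ≡ b ∧ a
    ∧-idem  : ∀ a → a ∧ a ≡ a
    top-max : ∀ a → a ≤ top
    bot-min : (h : HasBot K) → ∀ a → bot h ≤ a
    join-ubˡ : (h : HasJoin K) → ∀ a b → a ≤ join h a b
    join-ubʳ : (h : HasJoin K) → ∀ a b → b ≤ join h a b
    join-lub : (h : HasJoin K) → ∀ a b c → a ≤ c → b ≤ c → join h a b ≤ c
    distrib  : (h : HasJoin K) → ∀ a b c →
               a ∧ join h b c ≡ join h (a ∧ b) (a ∧ c)
    imp-mp  : (h : HasImp K) → ∀ a b → (imp h a b ∧ a) ≤ b
    imp-max : (h : HasImp K) → ∀ a b c → (c ∧ a) ≤ b → c ≤ imp h a b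
    neg-ann : (h : HasNeg K) → ∀ a → neg h a ∧ a ≡ bot (neg⇒bot h)
    neg-max : (h : HasNeg K) → ∀ a c → c ∧ a ≡ bot (neg⇒bot h) → c ≤ neg h a

record Hom {K : Variety} {ℓ : Level} (A B : Algebra K ℓ) : Set ℓ where
  private
    module A = Algebra A
    module B = Algebra B
  field
    fun : A.Carrier → B.Carrier
    pres-∧    : ∀ a b → fun (a A.∧ b) ≡ fun a B.∧ fun b
    pres-top  : fun A.top ≡ B.top
    pres-join : ∀ h a b → fun (A.join h a b) ≡ B.join h (fun a) (fun b)
    pres-imp  : ∀ h a b → fun (A.imp h a b) ≡ B.imp h (fun a) (fun b)
    pres-neg  : ∀ h a → fun (A.neg h a) ≡ B.neg h (fun a)
    pres-bot  : ∀ h → fun (A.bot h) ≡ B.bot h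

HomInjective : ∀ {K ℓ} {A B : Algebra K ℓ} → Hom A B → Set ℓ
HomInjective {A = A} f =
  ∀ (a b : Algebra.Carrier A) → Hom.fun f a ≡ Hom.fun f b → a ≡ b

module _ {K : Variety} {ℓ : Level} (A : Algebra K ℓ) where
  open Algebra A

  IsFilter : (Carrier → Set ℓ) → Set ℓ
  IsFilter F = (Σ Carrier F)
             × (∀ a b → a ≤ b → F a → F b)
             × (∀ a b → F a → F b → F (a ∧ b))

  IsMeetIrreducible : (Carrier → Set ℓ) → Set (suc ℓ)
  IsMeetIrreducible F =
      IsFilter F
    × (Σ Carrier λ a → ¬ F a)
    × ¬ (Σ (Carrier → Set ℓ) λ G → Σ (Carrier → Set ℓ) λ H →
           IsFilter G × IsFilter H
         × (F ≐ (λ a → G a × H a)) × ¬ (G ≐ F) × ¬ (H ≐ F))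

  MI-resp : ∀ {F F'} → F ≐ F' → IsMeetIrreducible F → IsMeetIrreducible F'
  MI-resp {F} {F'} e ((ne , up , cl) , (a , na) , irr) =
    ( (proj₁ ne , to (proj₁ ne) (proj₂ ne))
    , (λ a b a≤b Fa → to b (up a b a≤b (fr a Fa)))
    , (λ a b Fa Fb → to (a ∧ b) (cl a b (fr a Fa) (fr b Fb))) )
    , (a , λ F'a → na (fr a F'a))
    , λ { (G , H , fG , fH , eq , nG , nH) →
          irr (G , H , fG , fH
              , (λ x → (λ Fx → proj₁ (eq x) (to x Fx)) , (λ GH → fr x (proj₂ (eq x) GH)))
              , (λ GF → nG (λ x → (λ Gx → to x (proj₁ (GF x) Gx)) , (λ F'x → proj₂ (GF x) (fr x F'x))))
              , (λ HF → nH (λ x → (λ Hx → to x (proj₁ (HF x) Hx)) , (λ F'x → proj₂ (HF x) (fr x F'x))))) }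
    where
      to = λ x → proj₁ (e x)
      fr = λ x → proj₂ (e x)

  MIFilter : Set (suc ℓ)
  MIFilter = Σ (Carrier → Set ℓ) IsMeetIrreducible

  _∗ : Poset (suc ℓ) ℓ ℓ
  _∗ = record
    { Carrier = MIFilter
    ; _≈_ = λ F G → proj₁ F ≐ proj₁ G
    ; _≤_ = λ F G → proj₁ F ⊆ proj₁ G
    ; isPartialOrder = record
      { isPreorder = record
        { isEquivalence = record
          { refl  = λ x → (λ p → p) , (λ p → p)
          ; sym   = λ e x → proj₂ (e x) , proj₁ (e x)
          ; trans = λ e e' x → (λ p → proj₁ (e' x) (proj₁ (e x) p))
                             , (λ p → proj₂ (e x) (proj₂ (e' x) p)) }
        ; reflexive = λ e x → proj₁ (e x)
        ; trans = λ i j x p → j x (i x p) }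
      ; antisym = λ i j x → i x , j x }
    }

record PartialMap {c₁ ℓ₁ ℓ₂ c₂ ℓ₃ ℓ₄ : Level}
  (X : Poset c₁ ℓ₁ ℓ₂) (Y : Poset c₂ ℓ₃ ℓ₄) (d : Level)
  : Set (c₁ ⊔ ℓ₁ ⊔ c₂ ⊔ ℓ₃ ⊔ suc d) where
  private
    module X = Poset X
    module Y = Poset Y
  field
    dom : X.Carrier → Set d
    app : (x : X.Carrier) → dom x → Y.Carrier
    dom-resp : ∀ {x x'} → x X.≈ x' → dom x → dom x'
    app-resp : ∀ {x x'} (dx : dom x) (dx' : dom x') → x X.≈ x' →
               app x dx Y.≈ app x' dx'

module _ {c₁ ℓ₁ ℓ₂ c₂ ℓ₃ ℓ₄ d : Level}
  {X : Poset c₁ ℓ₁ ℓ₂} {Y : Poset c₂ ℓ₃ ℓ₄} (p : PartialMap X Y d) where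
  private
    module X = Poset X
    module Y = Poset Y
  open PartialMap p

  OrderPreserving : Set _
  OrderPreserving = ∀ x z (dx : dom x) (dz : dom z) →
    x X.≤ z → app x dx Y.≤ app z dz

  Surjective : Set _
  Surjective = ∀ (y : Y.Carrier) →
    Σ X.Carrier λ x → Σ (dom x) λ dx → app x dx Y.≈ y

  Total : Set _
  Total = ∀ x → dom x

  AlmostTotal : Set _
  AlmostTotal = ∀ x z → x X.≤ z → dom z → dom x

  NegCond₁ : Set _
  NegCond₁ = ∀ x → Σ X.Carrier λ x' → x X.≤ x' × (∀ z → x' X.≤ z → dom z)

  NegCond₂ : Set _
  NegCond₂ = ∀ x (dx : dom x) y → app x dx Y.≤ y →
    Σ X.Carrier λ z → Σ (dom z) λ dz → x X.≤ z × y Y.≤ app z dz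

  PosCond : Set _
  PosCond = ∀ x (dx : dom x) y → app x dx Y.≤ y →
    Σ X.Carrier λ z → Σ (dom z) λ dz → x X.≤ z × y Y.≈ app z dz

  IsPartialNegPMorphism : Set _
  IsPartialNegPMorphism = OrderPreserving × NegCond₁ × NegCond₂

  IsPartialPosPMorphism : Set _
  IsPartialPosPMorphism = OrderPreserving × PosCond

  IsPartialPMorphism : Set _
  IsPartialPMorphism = IsPartialNegPMorphism × IsPartialPosPMorphism

  -- the arrows of K^∂ (Lift only adjusts universe levels)
  IsArrow : Variety → Set (c₁ ⊔ ℓ₂ ⊔ c₂ ⊔ ℓ₃ ⊔ ℓ₄ ⊔ d)
  IsArrow PSL  = Lift ℓ₃ IsPartialNegPMorphism
  IsArrow ISL  = IsPartialPosPMorphism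
  IsArrow bISL = IsPartialPMorphism
  IsArrow PDL  = Lift ℓ₃ (Total × IsPartialNegPMorphism)
  IsArrow IL   = AlmostTotal × IsPartialPosPMorphism
  IsArrow HA   = Total × IsPartialPMorphism

module _ {K : Variety} {ℓ : Level} {A B : Algebra K ℓ} (f : Hom A B) where

  preimage : (Algebra.Carrier B → Set ℓ) → (Algebra.Carrier A → Set ℓ)
  preimage F a = F (Hom.fun f a)

  lower : PartialMap (B ∗) (A ∗) (suc ℓ)
  lower = record
    { dom = λ F → IsMeetIrreducible A (preimage (proj₁ F))
    ; app = λ F mi → preimage (proj₁ F) , mi
    ; dom-resp = λ e → MI-resp A (λ a → e (Hom.fun f a))
    ; app-resp = λ _ _ e a → e (Hom.fun f a)
    }

module _ {ℓ : Level} (X : Poset ℓ ℓ ℓ) where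
  open Poset X

  IsUpset : (Carrier → Set ℓ) → Set ℓ
  IsUpset U = ∀ x y → x ≤ y → U x → U y

  _∩_ : (U V : Carrier → Set ℓ) → Carrier → Set ℓ
  (U ∩ V) x = U x × V x

  _∪_ : (U V : Carrier → Set ℓ) → Carrier → Set ℓ
  (U ∪ V) x = U x ⊎ V x

  _⇒_ : (U V : Carrier → Set ℓ) → Carrier → Set ℓ
  (U ⇒ V) x = ¬ (Σ Carrier λ x' → x ≤ x' × U x' × ¬ V x')

  ∅ : Carrier → Set ℓ
  ∅ _ = Lift ℓ ⊥

  full : Carrier → Set ℓ
  full _ = Lift ℓ ⊤

  ∼_ : (Carrier → Set ℓ) → Carrier → Set ℓ
  ∼ U = U ⇒ ∅

module _ {ℓ : Level} {X Y : Poset ℓ ℓ ℓ} (p : PartialMap X Y ℓ) where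
  private
    module X = Poset X
    module Y = Poset Y
  open PartialMap p

  Up : (Y.Carrier → Set ℓ) → X.Carrier → Set ℓ
  Up U x = ¬ (Σ X.Carrier λ x' → x X.≤ x' × Σ (dom x') λ dx' → ¬ U (app x' dx'))

  record IsUpHom (K : Variety) : Set (suc ℓ) where
    field
      maps-upsets : ∀ U → IsUpset Y U → IsUpset X (Up U)
      pres-∩ : ∀ U V → IsUpset Y U → IsUpset Y V →
               Up (_∩_ Y U V) ≐ _∩_ X (Up U) (Up V)
      pres-full : Up (full Y) ≐ full X
      pres-∪ : HasJoin K → ∀ U V → IsUpset Y U → IsUpset Y V →
               Up (_∪_ Y U V) ≐ _∪_ X (Up U) (Up V)
      pres-⇒ : HasImp K → ∀ U V → IsUpset Y U → IsUpset Y V →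
               Up (_⇒_ Y U V) ≐ _⇒_ X (Up U) (Up V)
      pres-∼ : HasNeg K → ∀ U → IsUpset Y U →
               Up (∼_ Y U) ≐ ∼_ X (Up U)
      pres-∅ : HasBot K → Up (∅ Y) ≐ ∅ X

  UpInjective : Set (suc ℓ)
  UpInjective = ∀ U V → IsUpset Y U → IsUpset Y V → Up U ≐ Up V → U ≐ V

{-# OPTIONS --safe #-}
-- (i) Preimages of filters under homomorphisms are filters, so everything
-- hinges on producing meet irreducible filters of B with prescribed
-- preimages.  The basic tool: if G is meet irreducible in A and H is a filter
-- of B with f⁻¹[H] = G, a filter M ⊇ H maximal (Zorn) among those with
-- f⁻¹[M] ⊆ G is meet irreducible with f⁻¹[M] = G.  For f⁻¹[F] ⊆ G, taking for
-- H the filter generated by F ∪ f[G] (→ gives f⁻¹[H] ⊆ G) yields the positive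
-- p-morphism condition, and H generated by f[G] alone (f injective) yields
-- surjectivity.
-- In the presence of a pseudocomplement, filters containing a or ¬a for every
-- a and avoiding 0 are meet irreducible, maximal among proper filters and
-- stable under preimage; this gives the negative conditions.  In the presence
-- of ∨, meet irreducible filters are exactly the proper prime ones, and
-- preimages of prime filters are prime; this gives (almost) totality.
-- (ii) On dom(p), Up(p)(U) is p⁻¹[U]; each preservation law then reduces
-- classically to the matching condition on p.
module Submission where

open import Defs
open import Level using (Level; Lift; lift) renaming (suc to lsuc)
open import Data.Product using (_×_; Σ; _,_; proj₁; proj₂; swap)
open import Data.Sum using (_⊎_; inj₁; inj₂; [_,_]′)
open import Data.Empty using (⊥; ⊥-elim)
open import Data.Unit using (tt)
open import Relation.Nullary using (¬_)
open import Relation.Nullary.Decidable using (True; toWitness; fromWitness; toSum)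
open import Relation.Binary.PropositionalEquality using (_≡_; refl; sym; trans; cong; subst)
open import Relation.Binary.Bundles using (Poset)
open import Axiom.ExcludedMiddle using (ExcludedMiddle)
open import Axiom.DoubleNegationElimination using (em⇒dne)

module _ {a ℓ : Level} {A : Set a} where

  ≐⇒⊆ : {P Q : A → Set ℓ} → P ≐ Q → P ⊆ Q
  ≐⇒⊆ P≐Q x = proj₁ (P≐Q x)

  ≐-sym : {P Q : A → Set ℓ} → P ≐ Q → Q ≐ P
  ≐-sym P≐Q x = swap (P≐Q x)

  ≐∩⇒⊆ˡ : {P Q R : A → Set ℓ} → P ≐ (λ x → Q x × R x) → P ⊆ Q
  ≐∩⇒⊆ˡ P≐Q∩R x Px = proj₁ (proj₁ (P≐Q∩R x) Px)

  ≐∩⇒⊆ʳ : {P Q R : A → Set ℓ} → P ≐ (λ x → Q x × R x) → P ⊆ R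
  ≐∩⇒⊆ʳ P≐Q∩R x Px = proj₂ (proj₁ (P≐Q∩R x) Px)

module Classical (lem : ∀ {a} → ExcludedMiddle a) where

  by-cases : ∀ {a b} {P : Set a} {Q : Set b} → (P → Q) → (¬ P → Q) → Q
  by-cases f g = [ f , g ]′ (toSum lem)

  dne : ∀ {a} {P : Set a} → ¬ ¬ P → P
  dne = em⇒dne lem

  -- a copy of P in an arbitrary universe, equivalent to P by excluded middle
  Resize : ∀ {a} b → Set a → Set b
  Resize b P = Lift b (True (lem {P = P}))

  resize : ∀ {a b} {P : Set a} → P → Resize b P
  resize p = lift (fromWitness p)

  unresize : ∀ {a b} {P : Set a} → Resize b P → P
  unresize (lift t) = toWitness t

module SemilatticeOrder {K : Variety} {ℓ : Level} (A : Algebra K ℓ) where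
  open Algebra A

  ≤-refl : ∀ {a} → a ≤ a
  ≤-refl = ∧-idem _

  ≤-reflexive : ∀ {a b} → a ≡ b → a ≤ b
  ≤-reflexive refl = ≤-refl

  ≤-trans : ∀ {a b c} → a ≤ b → b ≤ c → a ≤ c
  ≤-trans {a} {b} {c} a≤b b≤c =
    trans (cong (_∧ c) (sym a≤b)) (trans (∧-assoc a b c) (trans (cong (a ∧_) b≤c) a≤b))

  ≤-antisym : ∀ {a b} → a ≤ b → b ≤ a → a ≡ b
  ≤-antisym {a} {b} a≤b b≤a = trans (sym a≤b) (trans (∧-comm a b) b≤a)

  x∧y≤y : ∀ a b → (a ∧ b) ≤ b
  x∧y≤y a b = trans (∧-assoc a b b) (cong (a ∧_) (∧-idem b))

  x∧y≤x : ∀ a b → (a ∧ b) ≤ a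
  x∧y≤x a b = trans (cong (_∧ a) (∧-comm a b)) (trans (x∧y≤y b a) (∧-comm b a))

  ∧-greatest : ∀ {a b c} → c ≤ a → c ≤ b → c ≤ (a ∧ b)
  ∧-greatest {a} {b} {c} c≤a c≤b = trans (sym (∧-assoc c a b)) (trans (cong (_∧ b) c≤a) c≤b)

  ∧-monotonic : ∀ {a b c d} → a ≤ b → c ≤ d → (a ∧ c) ≤ (b ∧ d)
  ∧-monotonic a≤b c≤d = ∧-greatest (≤-trans (x∧y≤x _ _) a≤b) (≤-trans (x∧y≤y _ _) c≤d)

module FilterProperties {K : Variety} {ℓ : Level} (A : Algebra K ℓ) where
  open Algebra A
  open SemilatticeOrder A

  Pred : Set (lsuc ℓ)
  Pred = Carrier → Set ℓ

  top-∈ : ∀ {F} → IsFilter A F → F top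
  top-∈ ((b , Fb) , up , _) = up b top (top-max b) Fb

  up-closed : ∀ {F} → IsFilter A F → ∀ {a b} → a ≤ b → F a → F b
  up-closed (_ , up , _) = up _ _

  ∧-closed : ∀ {F} → IsFilter A F → ∀ {a b} → F a → F b → F (a ∧ b)
  ∧-closed (_ , _ , cl) = cl _ _

  Proper : Pred → Set ℓ
  Proper F = Σ Carrier λ a → ¬ F a

  infix 8 ↑_
  ↑_ : Carrier → Pred
  ↑ c = c ≤_

  ↑-isFilter : ∀ c → IsFilter A (↑ c)
  ↑-isFilter c = (c , ≤-refl) , (λ _ _ a≤b c≤a → ≤-trans c≤a a≤b) , (λ _ _ → ∧-greatest)

  infixl 6 _∨ᶠ_
  _∨ᶠ_ : Pred → Pred → Pred
  (F ∨ᶠ G) b = Σ Carrier λ c → Σ Carrier λ d → F c × G d × (c ∧ d) ≤ b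

  ∨ᶠ-isFilter : ∀ {F G} → IsFilter A F → IsFilter A G → IsFilter A (F ∨ᶠ G)
  ∨ᶠ-isFilter fF fG =
      (top , top , top , top-∈ fF , top-∈ fG , top-max _)
    , (λ _ _ a≤b (c , d , Fc , Gd , cd≤a) → c , d , Fc , Gd , ≤-trans cd≤a a≤b)
    , λ { _ _ (c , d , Fc , Gd , cd≤a) (c' , d' , Fc' , Gd' , cd≤b) →
            (c ∧ c') , (d ∧ d') , ∧-closed fF Fc Fc' , ∧-closed fG Gd Gd'
          , ∧-greatest (≤-trans (∧-monotonic (x∧y≤x c c') (x∧y≤x d d')) cd≤a)
                       (≤-trans (∧-monotonic (x∧y≤y c c') (x∧y≤y d d')) cd≤b) }

  ∨ᶠ-upperˡ : ∀ {F G} → IsFilter A G → F ⊆ (F ∨ᶠ G)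
  ∨ᶠ-upperˡ fG b Fb = b , top , Fb , top-∈ fG , x∧y≤x b top

  ∨ᶠ-upperʳ : ∀ {F G} → IsFilter A F → G ⊆ (F ∨ᶠ G)
  ∨ᶠ-upperʳ fF b Gb = top , b , top-∈ fF , Gb , x∧y≤y top b

  ∨ᶠ-↑-elim : ∀ {F c b} → (F ∨ᶠ (↑ c)) b → Σ Carrier λ m → F m × (m ∧ c) ≤ b
  ∨ᶠ-↑-elim (m , d , Fm , c≤d , md≤b) = m , Fm , ≤-trans (∧-monotonic ≤-refl c≤d) md≤b

module MaximalFilters (lem : ∀ {a} → ExcludedMiddle a) (zorn : ∀ {a r} → Zorn a r)
                      {K : Variety} {ℓ : Level} (A : Algebra K ℓ) where
  open Algebra A
  open Classical lem
  open FilterProperties A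

  record FilterBetween (H Ok : Pred) : Set (lsuc ℓ) where
    field
      carrier  : Pred
      isFilter : IsFilter A carrier
      contains : H ⊆ carrier
      within   : carrier ⊆ Ok

  open FilterBetween

  MaximalWithin : Pred → Pred → Set (lsuc ℓ)
  MaximalWithin Ok M = ∀ {F} → IsFilter A F → M ⊆ F → F ⊆ Ok → F ⊆ M

  _⊆ᶠ_ : ∀ {H Ok} → FilterBetween H Ok → FilterBetween H Ok → Set ℓ
  F ⊆ᶠ G = carrier F ⊆ carrier G

  module ChainUnion {H Ok : Pred} (fH : IsFilter A H) (H⊆Ok : H ⊆ Ok)
                    (C : FilterBetween H Ok → Set (lsuc ℓ))
                    (chain : ∀ F G → C F → C G → F ⊆ᶠ G ⊎ G ⊆ᶠ F) where

    -- H is included so that the union of the empty chain is still a filter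
    InUnion : Carrier → Set (lsuc ℓ)
    InUnion b = H b ⊎ Σ (FilterBetween H Ok) λ F → C F × carrier F b

    InUnion-up : ∀ {a b} → a ≤ b → InUnion a → InUnion b
    InUnion-up a≤b (inj₁ Ha) = inj₁ (up-closed fH a≤b Ha)
    InUnion-up a≤b (inj₂ (F , CF , Fa)) = inj₂ (F , CF , up-closed (isFilter F) a≤b Fa)

    InUnion-∧ : ∀ {a b} → InUnion a → InUnion b → InUnion (a ∧ b)
    InUnion-∧ (inj₁ Ha) (inj₁ Hb) = inj₁ (∧-closed fH Ha Hb)
    InUnion-∧ {a} (inj₁ Ha) (inj₂ (F , CF , Fb)) =
      inj₂ (F , CF , ∧-closed (isFilter F) (contains F a Ha) Fb)
    InUnion-∧ {b = b} (inj₂ (F , CF , Fa)) (inj₁ Hb) =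
      inj₂ (F , CF , ∧-closed (isFilter F) Fa (contains F b Hb))
    InUnion-∧ {a} {b} (inj₂ (F , CF , Fa)) (inj₂ (G , CG , Gb)) with chain F G CF CG
    ... | inj₁ F⊆G = inj₂ (G , CG , ∧-closed (isFilter G) (F⊆G a Fa) Gb)
    ... | inj₂ G⊆F = inj₂ (F , CF , ∧-closed (isFilter F) Fa (G⊆F b Gb))

    InUnion-within : ∀ {b} → InUnion b → Ok b
    InUnion-within {b} (inj₁ Hb) = H⊆Ok b Hb
    InUnion-within {b} (inj₂ (F , _ , Fb)) = within F b Fb

    union : FilterBetween H Ok
    union = record
      { carrier  = λ b → Resize ℓ (InUnion b)
      ; isFilter = (top , resize (inj₁ (top-∈ fH)))
                 , (λ _ _ a≤b a∈ → resize (InUnion-up a≤b (unresize a∈)))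
                 , (λ _ _ a∈ b∈ → resize (InUnion-∧ (unresize a∈) (unresize b∈)))
      ; contains = λ _ Hb → resize (inj₁ Hb)
      ; within   = λ _ b∈ → InUnion-within (unresize b∈)
      }

    union-upper : ∀ F → C F → F ⊆ᶠ union
    union-upper F CF _ Fb = resize (inj₂ (F , CF , Fb))

  maximal-filter : ∀ {H Ok} → IsFilter A H → H ⊆ Ok →
    Σ (FilterBetween H Ok) λ M → MaximalWithin Ok (carrier M)
  maximal-filter {H} {Ok} fH H⊆Ok
    with zorn (FilterBetween H Ok) _⊆ᶠ_ (λ _ _ Fb → Fb) (λ _ _ _ F⊆G G⊆K b Fb → G⊆K b (F⊆G b Fb))
              (λ C chain → ChainUnion.union fH H⊆Ok C chain , ChainUnion.union-upper fH H⊆Ok C chain)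
  ... | M , maximal = M , λ {F} fF M⊆F F⊆Ok → maximal (record
        { carrier = F ; isFilter = fF ; contains = λ b Hb → M⊆F b (contains M b Hb) ; within = F⊆Ok })
        M⊆F

module HomProperties {K : Variety} {ℓ : Level} {A B : Algebra K ℓ} (f : Hom A B) where
  private
    module A = Algebra A
    module B = Algebra B
    module FA = FilterProperties A
  open Hom f
  open SemilatticeOrder B
  open FilterProperties B

  fun-monotone : ∀ {a b} → a A.≤ b → fun a B.≤ fun b
  fun-monotone {a} {b} a≤b = trans (sym (pres-∧ a b)) (cong fun a≤b)

  preimage-isFilter : ∀ {F} → IsFilter B F → IsFilter A (preimage f F)
  preimage-isFilter {F} fF =
      (A.top , subst F (sym pres-top) (top-∈ fF))
    , (λ _ _ a≤b Ffa → up-closed fF (fun-monotone a≤b) Ffa)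
    , (λ a b Ffa Ffb → subst F (sym (pres-∧ a b)) (∧-closed fF Ffa Ffb))

  lower-orderPreserving : OrderPreserving (lower f)
  lower-orderPreserving _ _ _ _ F⊆G a = F⊆G (fun a)

  image : FA.Pred → Pred
  image G b = Σ A.Carrier λ g → G g × fun g B.≤ b

  image-isFilter : ∀ {G} → IsFilter A G → IsFilter B (image G)
  image-isFilter fG =
      (fun A.top , A.top , FA.top-∈ fG , ≤-refl)
    , (λ _ _ a≤b (g , Gg , fg≤a) → g , Gg , ≤-trans fg≤a a≤b)
    , λ { _ _ (g , Gg , fg≤a) (g' , Gg' , fg'≤b) →
            (g A.∧ g') , FA.∧-closed fG Gg Gg'
          , subst (B._≤ _) (sym (pres-∧ g g')) (∧-monotonic fg≤a fg'≤b) }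

  ⊆-preimage-image : ∀ {G} → G ⊆ preimage f (image G)
  ⊆-preimage-image g Gg = g , Gg , ≤-refl

  preimage-image-⊆ : HomInjective f → ∀ {G} → IsFilter A G → preimage f (image G) ⊆ G
  preimage-image-⊆ injective fG a (g , Gg , fg≤fa) =
    FA.up-closed fG (injective (g A.∧ a) g (trans (pres-∧ g a) fg≤fa)) Gg

  ∨ᶠ-image-elim : ∀ {F G b} → (F ∨ᶠ image G) b →
    Σ B.Carrier λ c → Σ A.Carrier λ g → F c × G g × (c B.∧ fun g) B.≤ b
  ∨ᶠ-image-elim (c , d , Fc , (g , Gg , fg≤d) , cd≤b) =
    c , g , Fc , Gg , ≤-trans (∧-monotonic ≤-refl fg≤d) cd≤b

  -- c ∧ f g ≤ f a gives c ≤ f (g → a), so g → a ∈ G and hence a ∈ G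
  preimage-∨ᶠ-image-⊆ : HasImp K → ∀ {F G} → IsFilter B F → IsFilter A G →
    preimage f F ⊆ G → preimage f (F ∨ᶠ image G) ⊆ G
  preimage-∨ᶠ-image-⊆ h {F} fF fG f⁻¹F⊆G a x with ∨ᶠ-image-elim x
  ... | c , g , Fc , Gg , cfg≤fa =
    FA.up-closed fG (A.imp-mp h g a) (FA.∧-closed fG (f⁻¹F⊆G (A.imp h g a) F∋f[g→a]) Gg)
    where
      F∋f[g→a] : F (fun (A.imp h g a))
      F∋f[g→a] = subst F (sym (pres-imp h g a)) (up-closed fF (B.imp-max h (fun g) (fun a) c cfg≤fa) Fc)

module MeetIrreducibleExtension (lem : ∀ {a} → ExcludedMiddle a) (zorn : ∀ {a r} → Zorn a r)
                                {K : Variety} {ℓ : Level} {A B : Algebra K ℓ} (f : Hom A B) where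
  open Hom f
  open HomProperties f
  open MaximalFilters lem zorn B
  open FilterBetween
  open FilterProperties B

  -- M is maximal among the filters ⊇ H whose preimage stays inside G; a
  -- decomposition M = F₁ ∩ F₂ into strictly larger filters would pull back
  -- to a decomposition of G.
  extend-to-meetIrreducible : ∀ {G H} → IsMeetIrreducible A G → IsFilter B H → G ≐ preimage f H →
    Σ (MIFilter B) λ M → H ⊆ proj₁ M × G ≐ preimage f (proj₁ M)
  extend-to-meetIrreducible {G} {H} (fG , (a₀ , a₀∉G) , G-irreducible) fH G≐f⁻¹H =
      (carrier M , isFilter M , (fun a₀ , λ Ma₀ → a₀∉G (within M _ Ma₀ a₀ refl)) , M-irreducible)
    , contains M
    , G≐f⁻¹M
    where
      Avoids : Pred
      Avoids b = ∀ a → fun a ≡ b → G a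

      H-avoids : H ⊆ Avoids
      H-avoids _ Hb a refl = proj₂ (G≐f⁻¹H a) Hb

      maximal-M : Σ (FilterBetween H Avoids) λ M → MaximalWithin Avoids (carrier M)
      maximal-M = maximal-filter fH H-avoids

      M : FilterBetween H Avoids
      M = proj₁ maximal-M

      G≐f⁻¹M : G ≐ preimage f (carrier M)
      G≐f⁻¹M a = (λ Ga → contains M _ (proj₁ (G≐f⁻¹H a) Ga)) , (λ Ma → within M _ Ma a refl)

      escapes : ∀ {F} → IsFilter B F → carrier M ⊆ F → ¬ (F ≐ carrier M) → ¬ (preimage f F ⊆ G)
      escapes fF M⊆F F≠M f⁻¹F⊆G =
        F≠M λ b → proj₂ maximal-M fF M⊆F (λ { _ Fb a refl → f⁻¹F⊆G a Fb }) b , M⊆F b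

      M-irreducible : ¬ (Σ Pred λ F₁ → Σ Pred λ F₂ → IsFilter B F₁ × IsFilter B F₂
                           × (carrier M ≐ λ b → F₁ b × F₂ b) × ¬ (F₁ ≐ carrier M) × ¬ (F₂ ≐ carrier M))
      M-irreducible (F₁ , F₂ , fF₁ , fF₂ , M≐F₁∩F₂ , F₁≠M , F₂≠M) =
        G-irreducible
          ( preimage f F₁ , preimage f F₂ , preimage-isFilter fF₁ , preimage-isFilter fF₂
          , (λ a → (λ Ga → proj₁ (M≐F₁∩F₂ (fun a)) (proj₁ (G≐f⁻¹M a) Ga))
                 , (λ F₁₂ → proj₂ (G≐f⁻¹M a) (proj₂ (M≐F₁∩F₂ (fun a)) F₁₂)))
          , (λ G₁≐G → escapes fF₁ (≐∩⇒⊆ˡ M≐F₁∩F₂) F₁≠M (≐⇒⊆ G₁≐G))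
          , (λ G₂≐G → escapes fF₂ (≐∩⇒⊆ʳ M≐F₁∩F₂) F₂≠M (≐⇒⊆ G₂≐G)) )

  lower-posCond : HasImp K → PosCond (lower f)
  lower-posCond h (F , fF , _) _ (G , miG@(fG , _)) f⁻¹F⊆G
    with extend-to-meetIrreducible miG (∨ᶠ-isFilter fF (image-isFilter fG)) G≐f⁻¹[F∨fG]
    where
      G≐f⁻¹[F∨fG] : G ≐ preimage f (F ∨ᶠ image G)
      G≐f⁻¹[F∨fG] a = (λ Ga → ∨ᶠ-upperʳ fF (fun a) (⊆-preimage-image a Ga))
                    , preimage-∨ᶠ-image-⊆ h fF fG f⁻¹F⊆G a
  ... | M , F∨fG⊆M , G≐f⁻¹M =
      M , MI-resp A G≐f⁻¹M miG
    , (λ b Fb → F∨fG⊆M b (∨ᶠ-upperˡ (image-isFilter fG) b Fb)) , G≐f⁻¹M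

  lower-surjective : HomInjective f → Surjective (lower f)
  lower-surjective injective (G , miG@(fG , _))
    with extend-to-meetIrreducible miG (image-isFilter fG)
           (λ a → ⊆-preimage-image a , preimage-image-⊆ injective fG a)
  ... | M , _ , G≐f⁻¹M = M , MI-resp A G≐f⁻¹M miG , ≐-sym G≐f⁻¹M

record Pseudocomplementation {K : Variety} {ℓ : Level} (A : Algebra K ℓ) : Set ℓ where
  open Algebra A
  field
    bottom         : Carrier
    pc             : Carrier → Carrier
    bottom-min     : ∀ a → bottom ≤ a
    pc-annihilates : ∀ a → pc a ∧ a ≡ bottom
    pc-greatest    : ∀ a c → c ∧ a ≡ bottom → c ≤ pc a

neg-pseudocomplementation : ∀ {K ℓ} (A : Algebra K ℓ) → HasNeg K → Pseudocomplementation A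
neg-pseudocomplementation A h = record
  { bottom = bot (neg⇒bot h) ; pc = neg h ; bottom-min = bot-min _
  ; pc-annihilates = neg-ann h ; pc-greatest = neg-max h }
  where open Algebra A

imp-pseudocomplementation : ∀ {K ℓ} (A : Algebra K ℓ) → HasImp K → HasBot K → Pseudocomplementation A
imp-pseudocomplementation A h hb = record
  { bottom = bot hb ; pc = λ a → imp h a (bot hb) ; bottom-min = bot-min hb
  ; pc-annihilates = λ a → ≤-antisym (imp-mp h a (bot hb)) (bot-min hb _)
  ; pc-greatest = λ a c c∧a≡0 → imp-max h a (bot hb) c (≤-reflexive c∧a≡0) }
  where
    open Algebra A
    open SemilatticeOrder A

module CompleteFilters (lem : ∀ {a} → ExcludedMiddle a) (zorn : ∀ {a r} → Zorn a r)
                       {K : Variety} {ℓ : Level} {A : Algebra K ℓ} (P : Pseudocomplementation A) where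
  open Algebra A
  open Pseudocomplementation P
  open SemilatticeOrder A
  open FilterProperties A
  open Classical lem
  open MaximalFilters lem zorn A
  open FilterBetween

  Complete : Pred → Set ℓ
  Complete M = IsFilter A M × ¬ M bottom × (∀ a → M a ⊎ M (pc a))

  proper⇒bottom∉ : ∀ {F} → IsFilter A F → Proper F → ¬ F bottom
  proper⇒bottom∉ fF (a , a∉F) F0 = a∉F (up-closed fF (bottom-min a) F0)

  complete-maximal : ∀ {M F} → Complete M → IsFilter A F → ¬ F bottom → M ⊆ F → F ≐ M
  complete-maximal {M} {F} (_ , _ , M-complete) fF 0∉F M⊆F a = F⊆M , M⊆F a
    where
      F⊆M : F a → M a
      F⊆M Fa with M-complete a
      ... | inj₁ Ma = Ma
      ... | inj₂ M¬a = ⊥-elim (0∉F (subst F (pc-annihilates a) (∧-closed fF (M⊆F _ M¬a) Fa)))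

  complete⇒meetIrreducible : ∀ {M} → Complete M → IsMeetIrreducible A M
  complete⇒meetIrreducible {M} cM@(fM , 0∉M , _) =
      fM , (bottom , 0∉M)
    , λ { (F₁ , F₂ , fF₁ , fF₂ , M≐F₁∩F₂ , F₁≠M , F₂≠M) →
          by-cases
            (λ F₁0 → by-cases
               (λ F₂0 → 0∉M (proj₂ (M≐F₁∩F₂ bottom) (F₁0 , F₂0)))
               (λ 0∉F₂ → F₂≠M (complete-maximal cM fF₂ 0∉F₂ (≐∩⇒⊆ʳ M≐F₁∩F₂))))
            (λ 0∉F₁ → F₁≠M (complete-maximal cM fF₁ 0∉F₁ (≐∩⇒⊆ˡ M≐F₁∩F₂))) }

  -- a maximal filter avoiding 0 is complete: if a, pc a ∉ M, then the
  -- filter generated by M and a avoids 0 (m ∧ a ≤ 0 would put m ≤ pc a)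
  extend-to-complete : ∀ {H} → IsFilter A H → ¬ H bottom → Σ Pred λ M → Complete M × H ⊆ M
  extend-to-complete {H} fH 0∉H =
    carrier M , (isFilter M , (λ M0 → within M bottom M0 refl) , M-complete) , contains M
    where
      NonZero : Pred
      NonZero a = ¬ (a ≡ bottom)

      maximal-M : Σ (FilterBetween H NonZero) λ M → MaximalWithin NonZero (carrier M)
      maximal-M = maximal-filter fH (λ a Ha a≡0 → 0∉H (subst H a≡0 Ha))

      M : FilterBetween H NonZero
      M = proj₁ maximal-M

      M∨↑a-nonZero : ∀ {a} → ¬ carrier M (pc a) → (carrier M ∨ᶠ ↑ a) ⊆ NonZero
      M∨↑a-nonZero {a} ¬a∉M b x refl with ∨ᶠ-↑-elim x
      ... | m , Mm , ma≤0 =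
        ¬a∉M (up-closed (isFilter M) (pc-greatest a m (≤-antisym ma≤0 (bottom-min _))) Mm)

      M-complete : ∀ a → carrier M a ⊎ carrier M (pc a)
      M-complete a = by-cases inj₁ λ a∉M → by-cases inj₂ λ ¬a∉M → ⊥-elim (a∉M
        (proj₂ maximal-M (∨ᶠ-isFilter (isFilter M) (↑-isFilter a)) (∨ᶠ-upperˡ (↑-isFilter a))
          (M∨↑a-nonZero ¬a∉M) a (∨ᶠ-upperʳ (isFilter M) a ≤-refl)))

module LowerNegative (lem : ∀ {a} → ExcludedMiddle a) (zorn : ∀ {a r} → Zorn a r)
                     {K : Variety} {ℓ : Level} {A B : Algebra K ℓ} (f : Hom A B)
                     (PA : Pseudocomplementation A) (PB : Pseudocomplementation B)
                     (pres-bottom : Hom.fun f (Pseudocomplementation.bottom PA)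
                                      ≡ Pseudocomplementation.bottom PB)
                     (pres-pc : ∀ a → Hom.fun f (Pseudocomplementation.pc PA a)
                                      ≡ Pseudocomplementation.pc PB (Hom.fun f a))
                     where
  private
    module PA = Pseudocomplementation PA
    module PB = Pseudocomplementation PB
    module CA = CompleteFilters lem zorn PA
    module CB = CompleteFilters lem zorn PB
    module FA = FilterProperties A
  open Hom f
  open HomProperties f
  open SemilatticeOrder B
  open FilterProperties B

  preimage-complete : ∀ {M} → CB.Complete M → CA.Complete (preimage f M)
  preimage-complete {M} (fM , 0∉M , M-complete) =
    preimage-isFilter fM , (λ M0 → 0∉M (subst M pres-bottom M0)) , f⁻¹M-complete
    where
      f⁻¹M-complete : ∀ a → M (fun a) ⊎ M (fun (PA.pc a))
      f⁻¹M-complete a with M-complete (fun a)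
      ... | inj₁ Ma = inj₁ Ma
      ... | inj₂ M¬a = inj₂ (subst M (sym (pres-pc a)) M¬a)

  -- any filter above a complete filter M equals M, and f⁻¹[M] is complete
  lower-negCond₁ : NegCond₁ (lower f)
  lower-negCond₁ (F , fF , F-proper , _)
    with CB.extend-to-complete fF (CB.proper⇒bottom∉ fF F-proper)
  ... | M , cM , F⊆M = (M , CB.complete⇒meetIrreducible cM) , F⊆M , above-M-in-dom
    where
      above-M-in-dom : ∀ G → M ⊆ proj₁ G → IsMeetIrreducible A (preimage f (proj₁ G))
      above-M-in-dom (G , fG , G-proper , _) M⊆G =
        MI-resp A (λ a → ≐-sym G≐M (fun a)) (CA.complete⇒meetIrreducible (preimage-complete cM))
        where
          G≐M : G ≐ M
          G≐M = CB.complete-maximal cM fG (CB.proper⇒bottom∉ fG G-proper) M⊆G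

  lower-negCond₂ : NegCond₂ (lower f)
  lower-negCond₂ (F , fF , _) _ (G , fG , G-proper , _) f⁻¹F⊆G
    with CB.extend-to-complete (∨ᶠ-isFilter fF (image-isFilter fG)) 0∉F∨fG
    where
      -- c ∧ f g ≤ 0 gives c ≤ f (pc g), so pc g ∈ G and then 0 = pc g ∧ g ∈ G
      0∉F∨fG : ¬ (F ∨ᶠ image G) PB.bottom
      0∉F∨fG x with ∨ᶠ-image-elim x
      ... | c , g , Fc , Gg , cfg≤0 =
        CA.proper⇒bottom∉ fG G-proper
          (subst G (PA.pc-annihilates g) (FA.∧-closed fG (f⁻¹F⊆G (PA.pc g) F∋f[pc-g]) Gg))
        where
          F∋f[pc-g] : F (fun (PA.pc g))
          F∋f[pc-g] = subst F (sym (pres-pc g))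
            (up-closed fF (PB.pc-greatest (fun g) c (≤-antisym cfg≤0 (PB.bottom-min _))) Fc)
  ... | M , cM , F∨fG⊆M =
      (M , CB.complete⇒meetIrreducible cM) , CA.complete⇒meetIrreducible (preimage-complete cM)
    , (λ b Fb → F∨fG⊆M b (∨ᶠ-upperˡ (image-isFilter fG) b Fb))
    , (λ g Gg → F∨fG⊆M (fun g) (∨ᶠ-upperʳ fF (fun g) (⊆-preimage-image g Gg)))

module PrimeFilters (lem : ∀ {a} → ExcludedMiddle a)
                    {K : Variety} {ℓ : Level} (A : Algebra K ℓ) (h : HasJoin K) where
  open Algebra A
  open SemilatticeOrder A
  open FilterProperties A
  open Classical lem

  Prime : Pred → Set ℓ
  Prime M = ∀ a b → M (join h a b) → M a ⊎ M b

  ∧-join-≤ : ∀ {c d a b x} → (c ∧ a) ≤ x → (d ∧ b) ≤ x → ((c ∧ d) ∧ join h a b) ≤ x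
  ∧-join-≤ {c} {d} {a} {b} {x} ca≤x db≤x =
    subst (_≤ x) (sym (distrib h (c ∧ d) a b))
      (join-lub h _ _ x (≤-trans (∧-monotonic (x∧y≤x c d) ≤-refl) ca≤x)
                        (≤-trans (∧-monotonic (x∧y≤y c d) ≤-refl) db≤x))

  -- if a ∨ b ∈ M but a, b ∉ M, then M = (M ∨ ↑a) ∩ (M ∨ ↑b)
  meetIrreducible⇒prime : ∀ {M} → IsMeetIrreducible A M → Prime M
  meetIrreducible⇒prime {M} (fM , _ , M-irreducible) a b M[a∨b] =
    by-cases inj₁ λ a∉M → by-cases inj₂ λ b∉M → ⊥-elim (M-irreducible
      ( M ∨ᶠ ↑ a , M ∨ᶠ ↑ b , ∨ᶠ-isFilter fM (↑-isFilter a) , ∨ᶠ-isFilter fM (↑-isFilter b)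
      , M≐∩ , (λ ≐M → a∉M (≐⇒⊆ ≐M a (∈M∨↑ a))) , (λ ≐M → b∉M (≐⇒⊆ ≐M b (∈M∨↑ b)))))
    where
      ∈M∨↑ : ∀ c → (M ∨ᶠ ↑ c) c
      ∈M∨↑ c = ∨ᶠ-upperʳ fM c ≤-refl

      ∩⊆M : ∀ x → (M ∨ᶠ ↑ a) x → (M ∨ᶠ ↑ b) x → M x
      ∩⊆M x xa xb with ∨ᶠ-↑-elim xa | ∨ᶠ-↑-elim xb
      ... | m , Mm , ma≤x | m' , Mm' , m'b≤x =
        up-closed fM (∧-join-≤ ma≤x m'b≤x) (∧-closed fM (∧-closed fM Mm Mm') M[a∨b])

      M≐∩ : M ≐ λ x → (M ∨ᶠ ↑ a) x × (M ∨ᶠ ↑ b) x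
      M≐∩ x = (λ Mx → ∨ᶠ-upperˡ (↑-isFilter a) x Mx , ∨ᶠ-upperˡ (↑-isFilter b) x Mx)
            , (λ (xa , xb) → ∩⊆M x xa xb)

  -- if M = F₁ ∩ F₂ with a ∈ F₁ ∖ M and b ∈ F₂ ∖ M, then a ∨ b ∈ M
  prime⇒meetIrreducible : ∀ {M} → IsFilter A M → Proper M → Prime M → IsMeetIrreducible A M
  prime⇒meetIrreducible {M} fM M-proper M-prime =
      fM , M-proper
    , λ { (F₁ , F₂ , fF₁ , fF₂ , M≐F₁∩F₂ , F₁≠M , F₂≠M) →
          let a , F₁a , a∉M = outside (≐∩⇒⊆ˡ M≐F₁∩F₂) F₁≠M
              b , F₂b , b∉M = outside (≐∩⇒⊆ʳ M≐F₁∩F₂) F₂≠M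
          in [ a∉M , b∉M ]′ (M-prime a b (proj₂ (M≐F₁∩F₂ _)
               (up-closed fF₁ (join-ubˡ h a b) F₁a , up-closed fF₂ (join-ubʳ h a b) F₂b))) }
    where
      outside : ∀ {F} → M ⊆ F → ¬ (F ≐ M) → Σ Carrier λ a → F a × ¬ M a
      outside M⊆F F≠M = dne λ F⊆M → F≠M λ x → (λ Fx → dne λ x∉M → F⊆M (x , Fx , x∉M)) , M⊆F x

module LowerJoin (lem : ∀ {a} → ExcludedMiddle a)
                 {K : Variety} {ℓ : Level} {A B : Algebra K ℓ} (f : Hom A B) (h : HasJoin K) where
  private
    module A = Algebra A
    module B = Algebra B
    module PA = PrimeFilters lem A h
    module PB = PrimeFilters lem B h
  open Hom f
  open HomProperties f
  open FilterProperties B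

  preimage-prime : ∀ {M} → PB.Prime M → PA.Prime (preimage f M)
  preimage-prime {M} M-prime a b M[f[a∨b]] =
    M-prime (fun a) (fun b) (subst M (pres-join h a b) M[f[a∨b]])

  preimage-meetIrreducible : ∀ {M} → IsMeetIrreducible B M → FilterProperties.Proper A (preimage f M) →
    IsMeetIrreducible A (preimage f M)
  preimage-meetIrreducible miM f⁻¹M-proper =
    PA.prime⇒meetIrreducible (preimage-isFilter (proj₁ miM)) f⁻¹M-proper
      (preimage-prime (PB.meetIrreducible⇒prime miM))

  lower-almostTotal : AlmostTotal (lower f)
  lower-almostTotal (G , miG) _ G⊆F (_ , (a , fa∉F) , _) =
    preimage-meetIrreducible miG (a , λ fa∈G → fa∉F (G⊆F (fun a) fa∈G))

  lower-total : HasBot K → Total (lower f)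
  lower-total hb (G , miG@(fG , (b , b∉G) , _)) =
    preimage-meetIrreducible miG
      (A.bot hb , λ f0∈G → b∉G (up-closed fG (B.bot-min hb b) (subst G (pres-bot hb) f0∈G)))

module PartialMapProperties {c₁ ℓ₁ ℓ₂ c₂ ℓ₃ ℓ₄ d : Level}
  {X : Poset c₁ ℓ₁ ℓ₂} {Y : Poset c₂ ℓ₃ ℓ₄} (p : PartialMap X Y d) where
  private
    module X = Poset X
    module Y = Poset Y

  posCond⇒negCond₂ : PosCond p → NegCond₂ p
  posCond⇒negCond₂ pos x dx y px≤y with pos x dx y px≤y
  ... | z , dz , x≤z , y≈pz = z , dz , x≤z , Y.reflexive y≈pz

  total⇒negCond₁ : Total p → NegCond₁ p
  total⇒negCond₁ total x = x , X.refl , λ z _ → total z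

  total⇒almostTotal : Total p → AlmostTotal p
  total⇒almostTotal total x _ _ _ = total x

module UpProperties (lem : ∀ {a} → ExcludedMiddle a)
                    {ℓ : Level} {X Y : Poset ℓ ℓ ℓ} (p : PartialMap X Y ℓ) where
  private
    module X = Poset X
    module Y = Poset Y
  open PartialMap p
  open Classical lem

  Escape : (Y.Carrier → Set ℓ) → X.Carrier → Set ℓ
  Escape U x = Σ X.Carrier λ x' → x X.≤ x' × Σ (dom x') λ dx' → ¬ U (app x' dx')

  Up-isUpset : ∀ U → IsUpset X (Up p U)
  Up-isUpset U _ _ x≤y ↑x-ok (x' , y≤x' , dx' , px'∉U) = ↑x-ok (x' , X.trans x≤y y≤x' , dx' , px'∉U)

  Up-∩ : ∀ U V → Up p (_∩_ Y U V) ≐ _∩_ X (Up p U) (Up p V)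
  Up-∩ U V x =
      (λ ok → (λ (x' , x≤x' , dx' , ∉U) → ok (x' , x≤x' , dx' , λ UV → ∉U (proj₁ UV)))
            , (λ (x' , x≤x' , dx' , ∉V) → ok (x' , x≤x' , dx' , λ UV → ∉V (proj₂ UV))))
    , λ (okU , okV) (x' , x≤x' , dx' , ∉UV) →
        by-cases (λ px'∈U → okV (x' , x≤x' , dx' , λ px'∈V → ∉UV (px'∈U , px'∈V)))
                 (λ px'∉U → okU (x' , x≤x' , dx' , px'∉U))

  Up-full : Up p (full Y) ≐ full X
  Up-full x = (λ _ → lift tt) , λ _ (_ , _ , _ , ∉full) → ∉full (lift tt)

  -- two witnesses x₁, x₂ ≥ x against Up U and Up V give, via the downset dom(p),
  -- the single witness x against Up (U ∪ V)
  Up-∪ : OrderPreserving p → AlmostTotal p →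
    ∀ U V → IsUpset Y U → IsUpset Y V → Up p (_∪_ Y U V) ≐ _∪_ X (Up p U) (Up p V)
  Up-∪ monotone almostTotal U V U-up V-up x = to , from
    where
      to : Up p (_∪_ Y U V) x → _∪_ X (Up p U) (Up p V) x
      to ok = by-cases inj₁ λ ¬okU → by-cases inj₂ λ ¬okV → ⊥-elim (clash (dne ¬okU) (dne ¬okV))
        where
          clash : Escape U x → Escape V x → ⊥
          clash (x₁ , x≤x₁ , dx₁ , px₁∉U) (x₂ , x≤x₂ , dx₂ , px₂∉V) =
            ok (x , X.refl , dx , [ (λ pxU → px₁∉U (U-up _ _ (monotone x x₁ dx dx₁ x≤x₁) pxU))
                                  , (λ pxV → px₂∉V (V-up _ _ (monotone x x₂ dx dx₂ x≤x₂) pxV)) ]′)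
            where
              dx : dom x
              dx = almostTotal x x₁ x≤x₁ dx₁
      from : _∪_ X (Up p U) (Up p V) x → Up p (_∪_ Y U V) x
      from (inj₁ okU) (x' , x≤x' , dx' , ∉U∪V) = okU (x' , x≤x' , dx' , λ u → ∉U∪V (inj₁ u))
      from (inj₂ okV) (x' , x≤x' , dx' , ∉U∪V) = okV (x' , x≤x' , dx' , λ v → ∉U∪V (inj₂ v))

  Up-on-dom : ∀ U {x} (dx : dom x) → Up p U x → U (app x dx)
  Up-on-dom _ dx ok = dne λ px∉U → ok (_ , X.refl , dx , px∉U)

  on-dom-Up : OrderPreserving p → ∀ {U} → IsUpset Y U → ∀ {x} (dx : dom x) → U (app x dx) → Up p U x
  on-dom-Up monotone U-up {x} dx pxU (x' , x≤x' , dx' , px'∉U) =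
    px'∉U (U-up _ _ (monotone x x' dx dx' x≤x') pxU)

  Up-⇒ : OrderPreserving p → PosCond p →
    ∀ U V → IsUpset Y U → IsUpset Y V → Up p (_⇒_ Y U V) ≐ _⇒_ X (Up p U) (Up p V)
  Up-⇒ monotone pos U V U-up V-up x = to , from
    where
      to : Up p (_⇒_ Y U V) x → _⇒_ X (Up p U) (Up p V) x
      to ok (x' , x≤x' , okU , ¬okV) with dne ¬okV
      ... | x'' , x'≤x'' , dx'' , px''∉V =
        ok (x'' , X.trans x≤x' x'≤x'' , dx''
           , λ U⇒V → U⇒V (_ , Y.refl , Up-on-dom U dx'' (Up-isUpset U _ _ x'≤x'' okU) , px''∉V))

      from : _⇒_ X (Up p U) (Up p V) x → Up p (_⇒_ Y U V) x
      from ok (x' , x≤x' , dx' , px'∉U⇒V) with dne px'∉U⇒V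
      ... | y , px'≤y , Uy , y∉V with pos x' dx' y px'≤y
      ... | z , dz , x'≤z , y≈pz =
        ok (z , X.trans x≤x' x'≤z
           , on-dom-Up monotone U-up dz (U-up _ _ (Y.reflexive y≈pz) Uy)
           , λ okV → y∉V (V-up _ _ (Y.reflexive (Y.Eq.sym y≈pz)) (Up-on-dom V dz okV)))

  Up-∼ : OrderPreserving p → NegCond₁ p → NegCond₂ p →
    ∀ U → IsUpset Y U → Up p (∼_ Y U) ≐ ∼_ X (Up p U)
  Up-∼ monotone neg₁ neg₂ U U-up x = to , from
    where
      to : Up p (∼_ Y U) x → ∼_ X (Up p U) x
      to ok (x' , x≤x' , okU , _) with neg₁ x'
      ... | x'' , x'≤x'' , ↑x''⊆dom =
        ok (x'' , X.trans x≤x' x'≤x'' , dx''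
           , λ ∼U → ∼U (_ , Y.refl , Up-on-dom U dx'' (Up-isUpset U _ _ x'≤x'' okU) , λ ()))
        where
          dx'' : dom x''
          dx'' = ↑x''⊆dom x'' X.refl

      from : ∼_ X (Up p U) x → Up p (∼_ Y U) x
      from ok (x' , x≤x' , dx' , px'∉∼U) with dne px'∉∼U
      ... | y , px'≤y , Uy , _ with neg₂ x' dx' y px'≤y
      ... | z , dz , x'≤z , y≤pz =
        ok (z , X.trans x≤x' x'≤z , on-dom-Up monotone U-up dz (U-up _ _ y≤pz Uy) , λ ())

  Up-∅ : NegCond₁ p → Up p (∅ Y) ≐ ∅ X
  Up-∅ neg₁ x with neg₁ x
  ... | x' , x≤x' , ↑x'⊆dom = (λ ok → lift (ok (x' , x≤x' , ↑x'⊆dom x' X.refl , λ ()))) , λ ()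

  Up-reflects-⊆ : OrderPreserving p → Surjective p →
    ∀ {U V} → IsUpset Y U → IsUpset Y V → Up p U ⊆ Up p V → U ⊆ V
  Up-reflects-⊆ monotone surjective {U} {V} U-up V-up UpU⊆UpV y Uy with surjective y
  ... | x , dx , px≈y =
    V-up _ _ (Y.reflexive px≈y)
      (Up-on-dom V dx (UpU⊆UpV x (on-dom-Up monotone U-up dx (U-up _ _ (Y.reflexive (Y.Eq.sym px≈y)) Uy))))

  Up-injective : OrderPreserving p → Surjective p → UpInjective p
  Up-injective monotone surjective U V U-up V-up UpU≐UpV y =
      Up-reflects-⊆ monotone surjective {U} {V} U-up V-up (λ x → proj₁ (UpU≐UpV x)) y
    , Up-reflects-⊆ monotone surjective {V} {U} V-up U-up (λ x → proj₂ (UpU≐UpV x)) y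

  Up-isUpHom : ∀ K → OrderPreserving p →
    (HasJoin K → AlmostTotal p) → (HasImp K → PosCond p) →
    (HasNeg K → NegCond₁ p × NegCond₂ p) → (HasBot K → NegCond₁ p) → IsUpHom p K
  Up-isUpHom K monotone join imp neg bot = record
    { maps-upsets = λ U _ → Up-isUpset U
    ; pres-∩      = λ U V _ _ → Up-∩ U V
    ; pres-full   = Up-full
    ; pres-∪      = λ h → Up-∪ monotone (join h)
    ; pres-⇒      = λ h → Up-⇒ monotone (imp h)
    ; pres-∼      = λ h → Up-∼ monotone (proj₁ (neg h)) (proj₂ (neg h))
    ; pres-∅      = λ h → Up-∅ (bot h)
    }

module Duality (lem : ∀ {a} → ExcludedMiddle a) (zorn : ∀ {a r} → Zorn a r) {ℓ : Level} where

  module NegLower {K : Variety} {A B : Algebra K ℓ} (f : Hom A B) (h : HasNeg K) =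
    LowerNegative lem zorn f (neg-pseudocomplementation A h) (neg-pseudocomplementation B h)
      (Hom.pres-bot f (neg⇒bot h)) (Hom.pres-neg f h)

  module ImpLower {K : Variety} {A B : Algebra K ℓ} (f : Hom A B) (h : HasImp K) (hb : HasBot K) =
    LowerNegative lem zorn f (imp-pseudocomplementation A h hb) (imp-pseudocomplementation B h hb)
      (Hom.pres-bot f hb)
      (λ a → trans (Hom.pres-imp f h a _) (cong (Algebra.imp B h (Hom.fun f a)) (Hom.pres-bot f hb)))

  open HomProperties using (lower-orderPreserving)
  open MeetIrreducibleExtension lem zorn using (lower-posCond)
  open LowerJoin lem using (lower-total; lower-almostTotal)
  open PartialMapProperties using (posCond⇒negCond₂; total⇒negCond₁; total⇒almostTotal)
  open UpProperties lem using (Up-isUpHom)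

  lower-isArrow : ∀ K {A B : Algebra K ℓ} (f : Hom A B) → IsArrow (lower f) K
  lower-isArrow PSL f =
    lift (lower-orderPreserving f , NegLower.lower-negCond₁ f tt , NegLower.lower-negCond₂ f tt)
  lower-isArrow ISL f = lower-orderPreserving f , lower-posCond f tt
  lower-isArrow bISL f =
      (lower-orderPreserving f , ImpLower.lower-negCond₁ f tt tt
      , posCond⇒negCond₂ (lower f) (lower-posCond f tt))
    , (lower-orderPreserving f , lower-posCond f tt)
  lower-isArrow PDL f =
    lift (lower-total f tt tt , lower-orderPreserving f
         , total⇒negCond₁ (lower f) (lower-total f tt tt) , NegLower.lower-negCond₂ f tt)
  lower-isArrow IL f = lower-almostTotal f tt , lower-orderPreserving f , lower-posCond f tt
  lower-isArrow HA f =
      lower-total f tt tt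
    , (lower-orderPreserving f , total⇒negCond₁ (lower f) (lower-total f tt tt)
      , posCond⇒negCond₂ (lower f) (lower-posCond f tt))
    , (lower-orderPreserving f , lower-posCond f tt)

  isArrow⇒orderPreserving : ∀ K {X Y : Poset ℓ ℓ ℓ} (p : PartialMap X Y ℓ) →
    IsArrow p K → OrderPreserving p
  isArrow⇒orderPreserving PSL p (lift (monotone , _)) = monotone
  isArrow⇒orderPreserving ISL p (monotone , _) = monotone
  isArrow⇒orderPreserving bISL p ((monotone , _) , _) = monotone
  isArrow⇒orderPreserving PDL p (lift (_ , monotone , _)) = monotone
  isArrow⇒orderPreserving IL p (_ , monotone , _) = monotone
  isArrow⇒orderPreserving HA p (_ , (monotone , _) , _) = monotone

  isArrow⇒isUpHom : ∀ K {X Y : Poset ℓ ℓ ℓ} (p : PartialMap X Y ℓ) → IsArrow p K → IsUpHom p K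
  isArrow⇒isUpHom PSL p (lift (monotone , neg₁ , neg₂)) =
    Up-isUpHom p PSL monotone (λ ()) (λ ()) (λ _ → neg₁ , neg₂) (λ _ → neg₁)
  isArrow⇒isUpHom ISL p (monotone , pos) =
    Up-isUpHom p ISL monotone (λ ()) (λ _ → pos) (λ ()) (λ ())
  isArrow⇒isUpHom bISL p ((monotone , neg₁ , _) , (_ , pos)) =
    Up-isUpHom p bISL monotone (λ ()) (λ _ → pos) (λ ()) (λ _ → neg₁)
  isArrow⇒isUpHom PDL p (lift (total , monotone , neg₁ , neg₂)) =
    Up-isUpHom p PDL monotone (λ _ → total⇒almostTotal p total) (λ ()) (λ _ → neg₁ , neg₂) (λ _ → neg₁)
  isArrow⇒isUpHom IL p (almostTotal , monotone , pos) =
    Up-isUpHom p IL monotone (λ _ → almostTotal) (λ _ → pos) (λ ()) (λ ())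
  isArrow⇒isUpHom HA p (total , (monotone , neg₁ , _) , (_ , pos)) =
    Up-isUpHom p HA monotone (λ _ → total⇒almostTotal p total) (λ _ → pos) (λ ()) (λ _ → neg₁)

proposition3p5 : (∀ {a} → ExcludedMiddle a) → (∀ {a r} → Zorn a r) →
    ∀ {ℓ : Level} (K : Variety) →
      (∀ (A B : Algebra K ℓ) (f : Hom A B) →
         IsArrow (lower f) K × (HomInjective f → Surjective (lower f)))
    × (∀ (X Y : Poset ℓ ℓ ℓ) (p : PartialMap X Y ℓ) → IsArrow p K →
         IsUpHom p K × (Surjective p → UpInjective p))
proposition3p5 lem zorn K =
    (λ A B f → lower-isArrow K f , lower-surjective f)
  , (λ X Y p arrow → isArrow⇒isUpHom K p arrow , Up-injective p (isArrow⇒orderPreserving K p arrow))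
  where
    open Duality lem zorn
    open MeetIrreducibleExtension lem zorn using (lower-surjective)
    open UpProperties lem using (Up-injective)
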